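{- For integers $n\ge 1$ and $k\ge 1$, let $M_{n,2k}$ be the number of $n\times 2k$ matrices with entries in $\{+1,-1\}$ such that each row contains exactly $k$ entries $+1$ and $k$ entries $-1$, and no two columns are identical. Then for each fixed integer $k\ge 3$ there exists $N$ such that for all $n\ge N$, \[ M_{n,2k}^2>M_{n-1,2k}\,M_{n+1,2k}. \] -}

module Defs where

open import Data.Nat using (ℕ; zero; suc; _*_; _≟_)
open import Data.Bool using (Bool; true; false)
open import Data.Fin using (Fin)
open import Data.Vec using (Vec; []; _∷_; lookup; map; count; allFin)
open import Data.List using (List; []; _∷_; length; filter; concatMap)
import Data.List as L
open import Data.Vec.Relation.Unary.All using (All; all?)
open import Data.Product using (_×_)
open import Relation.Binary.PropositionalEquality using (_≡_)
open import Relation.Nullary using (¬_; Dec)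
open import Relation.Unary using (Decidable)
import Data.Vec.Properties as VP
import Data.Fin.Properties as FP
open import Data.Bool.Properties using () renaming (_≟_ to _≟B_)
open import Data.Bool using (T)
open import Relation.Nullary.Decidable using (¬?; _→-dec_)
open import Function using (_∘_)

-- A ±1 entry is encoded as a Bool: true = +1, false = -1.
-- An n × m matrix is a vector of n rows, each a vector of m entries.
Matrix : ℕ → ℕ → Set
Matrix n m = Vec (Vec Bool m) n

column : ∀ {n m} → Matrix n m → Fin m → Vec Bool n
column rows j = map (λ r → lookup r j) rows

plusCount : ∀ {m} → Vec Bool m → ℕ
plusCount = count (λ b → b ≟B true)

RowsBalanced : ∀ {n} (k : ℕ) → Matrix n (2 * k) → Set
RowsBalanced k A = All (λ r → plusCount r ≡ k) A

ColumnsDistinct : ∀ {n m} → Matrix n m → Set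
ColumnsDistinct {m = m} A =
  All (λ i → All (λ j → ¬ (i ≡ j) → ¬ (column A i ≡ column A j)) (allFin m)) (allFin m)

Admissible : ∀ {n} (k : ℕ) → Matrix n (2 * k) → Set
Admissible k A = RowsBalanced k A × ColumnsDistinct A

admissible? : ∀ {n} (k : ℕ) → Decidable (Admissible {n} k)
admissible? k A =
  Relation.Nullary.Decidable._×-dec_
    (all? (λ r → plusCount r ≟ k) A)
    (all? (λ i → all? (λ j → ¬? (i FP.≟ j) →-dec ¬? (VP.≡-dec _≟B_ (column A i) (column A j))) (allFin _)) (allFin _))

allVecs : (m : ℕ) → List (Vec Bool m)
allVecs zero = [] ∷ []
allVecs (suc m) = concatMap (λ v → (true ∷ v) ∷ (false ∷ v) ∷ []) (allVecs m)

allMatrices : (n m : ℕ) → List (Matrix n m)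
allMatrices zero m = [] ∷ []
allMatrices (suc n) m = concatMap (λ A → L.map (_∷ A) (allVecs m)) (allMatrices n m)

-- M n k = M_{n,2k}: the number of n × 2k ±1 matrices with every row having
-- exactly k entries +1 and k entries -1, and no two columns identical.
M : ℕ → ℕ → ℕ
M n k = length (filter (admissible? {n} k) (allMatrices n (2 * k)))

module Submission where

-- M n k counts n-tuples of balanced rows (k ones among 2k entries) that avoid every event
-- "columns i and j coincide", i < j. Let T be the number of balanced rows and a the number of
-- balanced rows with equal entries at two given positions; a does not depend on the positions,
-- and for k ≥ 3 the balanced rows satisfying two different such constraints number at most a − 1.
-- With p column pairs and q pairs of column pairs, the Bonferroni inequalities give
--   Tⁿ ≤ M n k + p aⁿ ≤ Tⁿ + q (a − 1)ⁿ.
-- Substituting M n k = Tⁿ − p aⁿ + O((a − 1)ⁿ) into M(n)² − M(n − 1) M(n + 1), the main terms leave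
-- p (T − a)² aⁿ⁻¹ Tⁿ⁻¹, which beats the error O(Tⁿ (a − 1)ⁿ) for large n since ((a − 1)/a)ⁿ → 0.

open import Defs
open import Algebra.Bundles using (CommutativeMonoid)
open import Level using (Level)
open import Function using (_∘_; id)
open import Function.Bundles using (_⇔_; mk⇔)
open import Data.Bool using (Bool; true; false; _∧_; not)
import Data.Bool.Properties as Boolₚ
open import Data.Maybe using (Maybe; just; nothing)
open import Data.Nat using (ℕ; zero; suc; _+_; _*_; _^_; _∸_; _≤_; _<_; _≥_; z≤n; s≤s; _≤?_; _≡ᵇ_; >-nonZero)
open import Data.Nat.Properties
open import Data.Nat.Combinatorics using (_C_; nC1≡n; nCk+nC[k+1]≡[n+1]C[k+1])
open import Data.Nat.Tactic.RingSolver using (solve-∀)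
open import Data.Fin using (Fin; zero; suc)
import Data.Fin as F
import Data.Fin.Properties as Finₚ
open import Data.List using (List; []; _∷_; length; filter; concatMap; _++_; map; cartesianProduct)
import Data.List as List
open import Data.List.Membership.Propositional using (_∈_)
open import Data.List.Membership.Propositional.Properties
  using (∈-length; ∈-concatMap⁺; ∈-filter⁺; ∈-cartesianProduct⁺; ∈-allFin)
open import Data.List.Relation.Unary.Any using (here; there)
import Data.List.Relation.Unary.Any as Any
open import Data.List.Relation.Unary.All using (All; []; _∷_)
import Data.List.Relation.Unary.All as All
import Data.List.Relation.Unary.All.Properties as Allₚ
import Data.List.Relation.Unary.AllPairs as AllPairs
open import Data.List.Relation.Unary.Unique.Propositional using (Unique)
import Data.List.Relation.Unary.Unique.Propositional.Properties as Uniqueₚ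
open import Data.Vec using (Vec; []; _∷_; lookup; _[_]≔_; countᵇ; replicate)
import Data.Vec as Vec
import Data.Vec.Properties as Vecₚ
import Data.Vec.Relation.Unary.All as VecAll
import Data.Vec.Relation.Unary.All.Properties as VecAllₚ
open import Data.Product using (_×_; _,_; proj₁; proj₂; ∃; ∃-syntax)
import Data.Product as Product
open import Data.Sum using (_⊎_; inj₁; inj₂)
open import Relation.Binary.PropositionalEquality
open import Relation.Binary.Definitions using (tri<; tri≈; tri>)
open import Relation.Nullary using (Dec; yes; no; does; contradiction)
open import Relation.Nullary.Decidable using (dec-true; dec-false; does-⇔; ¬?; _→-dec_)
open import Relation.Unary using (Pred; Decidable)
open import Algebra.Properties.CommutativeSemigroup +-commutativeSemigroup
  using () renaming (interchange to +-interchange; xy∙z≈zy∙x to +-rotate; xy∙z≈xz∙y to +-right-comm)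
open import Algebra.Properties.CommutativeSemigroup *-commutativeSemigroup
  using () renaming (x∙yz≈y∙xz to *-left-comm)
open import Algebra.Properties.CommutativeSemigroup (CommutativeMonoid.commutativeSemigroup Boolₚ.∧-commutativeMonoid)
  using () renaming (interchange to ∧-interchange; x∙yz≈y∙xz to ∧-left-comm)

private
  variable
    ℓ : Level
    X Y : Set ℓ

-- Finite sums

𝟙 : Bool → ℕ
𝟙 true  = 1
𝟙 false = 0

𝟙-∧ : ∀ a b → 𝟙 (a ∧ b) ≡ 𝟙 a * 𝟙 b
𝟙-∧ true  b = sym (*-identityˡ (𝟙 b))
𝟙-∧ false b = refl

𝟙-∧-≤ : ∀ a b → 𝟙 (a ∧ b) ≤ 𝟙 a
𝟙-∧-≤ true  true  = ≤-refl
𝟙-∧-≤ true  false = z≤n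
𝟙-∧-≤ false b     = z≤n

∑ : List X → (X → ℕ) → ℕ
∑ []       f = 0
∑ (x ∷ xs) f = f x + ∑ xs f

infix 5 ∑
syntax ∑ xs (λ x → e) = ∑[ x ∈ xs ] e

length-filter : ∀ {p} {P : Pred X p} (P? : Decidable P) (xs : List X) →
                length (filter P? xs) ≡ ∑[ x ∈ xs ] 𝟙 (does (P? x))
length-filter P? []       = refl
length-filter P? (x ∷ xs) with does (P? x)
... | true  = cong suc (length-filter P? xs)
... | false = length-filter P? xs

∑-++ : (xs ys : List X) (f : X → ℕ) → ∑ (xs ++ ys) f ≡ ∑ xs f + ∑ ys f
∑-++ []       ys f = refl
∑-++ (x ∷ xs) ys f = trans (cong (f x +_) (∑-++ xs ys f)) (sym (+-assoc (f x) _ _))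

∑-cong : {f g : X → ℕ} → (∀ x → f x ≡ g x) → (xs : List X) → ∑ xs f ≡ ∑ xs g
∑-cong f≗g []       = refl
∑-cong f≗g (x ∷ xs) = cong₂ _+_ (f≗g x) (∑-cong f≗g xs)

∑-mono-≤ : {f g : X → ℕ} → (∀ x → f x ≤ g x) → (xs : List X) → ∑ xs f ≤ ∑ xs g
∑-mono-≤ f≤g []       = z≤n
∑-mono-≤ f≤g (x ∷ xs) = +-mono-≤ (f≤g x) (∑-mono-≤ f≤g xs)

∑-mono-< : {f g : X → ℕ} → (∀ x → f x ≤ g x) → ∀ {y xs} → y ∈ xs → f y < g y → ∑ xs f < ∑ xs g
∑-mono-< f≤g {xs = x ∷ xs} (here refl) fy<gy = +-mono-<-≤ fy<gy (∑-mono-≤ f≤g xs)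
∑-mono-< f≤g {xs = x ∷ xs} (there y∈xs) fy<gy = +-mono-≤-< (f≤g x) (∑-mono-< f≤g y∈xs fy<gy)

∑-+ : (xs : List X) (f g : X → ℕ) → ∑[ x ∈ xs ] (f x + g x) ≡ ∑ xs f + ∑ xs g
∑-+ []       f g = refl
∑-+ (x ∷ xs) f g =
  trans (cong (f x + g x +_) (∑-+ xs f g)) (+-interchange (f x) (g x) (∑ xs f) (∑ xs g))

∑-*ˡ : (c : ℕ) (xs : List X) (f : X → ℕ) → ∑[ x ∈ xs ] c * f x ≡ c * ∑ xs f
∑-*ˡ c []       f = sym (*-zeroʳ c)
∑-*ˡ c (x ∷ xs) f = trans (cong (c * f x +_) (∑-*ˡ c xs f)) (sym (*-distribˡ-+ c (f x) _))

∑-*ʳ : (c : ℕ) (xs : List X) (f : X → ℕ) → ∑[ x ∈ xs ] f x * c ≡ ∑ xs f * c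
∑-*ʳ c []       f = refl
∑-*ʳ c (x ∷ xs) f = trans (cong (f x * c +_) (∑-*ʳ c xs f)) (sym (*-distribʳ-+ c (f x) _))

∑-const : ∀ c {f : X → ℕ} {xs} → All (λ x → f x ≡ c) xs → ∑ xs f ≡ length xs * c
∑-const c []           = refl
∑-const c (fx≡c ∷ fxs) = cong₂ _+_ fx≡c (∑-const c fxs)

∑-≤-const : ∀ c {f : X → ℕ} {xs} → All (λ x → f x ≤ c) xs → ∑ xs f ≤ length xs * c
∑-≤-const c []           = z≤n
∑-≤-const c (fx≤c ∷ fxs) = +-mono-≤ fx≤c (∑-≤-const c fxs)

∑≡0⇒ : {f : X → ℕ} (xs : List X) → ∑ xs f ≡ 0 → ∀ {y} → y ∈ xs → f y ≡ 0
∑≡0⇒ {f = f} (x ∷ xs) ∑≡0 (here refl)  = m+n≡0⇒m≡0 (f x) ∑≡0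
∑≡0⇒ {f = f} (x ∷ xs) ∑≡0 (there y∈xs) = ∑≡0⇒ xs (m+n≡0⇒n≡0 (f x) ∑≡0) y∈xs

∑-map : (g : X → Y) (xs : List X) (f : Y → ℕ) → ∑ (map g xs) f ≡ ∑[ x ∈ xs ] f (g x)
∑-map g []       f = refl
∑-map g (x ∷ xs) f = cong (f (g x) +_) (∑-map g xs f)

∑-concatMap : (g : X → List Y) (xs : List X) (f : Y → ℕ) →
              ∑ (concatMap g xs) f ≡ ∑[ x ∈ xs ] ∑ (g x) f
∑-concatMap g []       f = refl
∑-concatMap g (x ∷ xs) f = trans (∑-++ (g x) (concatMap g xs) f) (cong (∑ (g x) f +_) (∑-concatMap g xs f))

∑-zero : (xs : List X) → ∑[ x ∈ xs ] 0 ≡ 0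
∑-zero []       = refl
∑-zero (x ∷ xs) = ∑-zero xs

∑-comm : (xs : List X) (ys : List Y) (h : X → Y → ℕ) →
         ∑[ x ∈ xs ] ∑[ y ∈ ys ] h x y ≡ ∑[ y ∈ ys ] ∑[ x ∈ xs ] h x y
∑-comm []       ys h = sym (∑-zero ys)
∑-comm (x ∷ xs) ys h = trans (cong (∑ ys (h x) +_) (∑-comm xs ys h)) (sym (∑-+ ys (h x) _))

∑-comm-*ˡ : (ys : List Y) (xs : List X) (w : X → ℕ) (f : Y → X → ℕ) →
            ∑[ y ∈ ys ] ∑[ x ∈ xs ] w x * f y x ≡ ∑[ x ∈ xs ] w x * (∑[ y ∈ ys ] f y x)
∑-comm-*ˡ ys xs w f = trans (∑-comm ys xs (λ y x → w x * f y x)) (∑-cong (λ x → ∑-*ˡ (w x) ys (λ y → f y x)) xs)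

pairsOf : List X → List (X × X)
pairsOf []       = []
pairsOf (x ∷ xs) = map (x ,_) xs ++ pairsOf xs

∑-pairsOf : (xs : List X) (b : X → Bool) →
            ∑[ xy ∈ pairsOf xs ] 𝟙 (b (proj₁ xy) ∧ b (proj₂ xy)) ≡ (∑[ x ∈ xs ] 𝟙 (b x)) C 2
∑-pairsOf []       b = refl
∑-pairsOf (x ∷ xs) b = begin
  ∑ (map (x ,_) xs ++ pairsOf xs) f                  ≡⟨ ∑-++ (map (x ,_) xs) (pairsOf xs) f ⟩
  ∑ (map (x ,_) xs) f + ∑ (pairsOf xs) f             ≡⟨ cong₂ _+_ (∑-map (x ,_) xs f) (∑-pairsOf xs b) ⟩
  (∑[ y ∈ xs ] 𝟙 (b x ∧ b y)) + count C 2            ≡⟨ cong (_+ count C 2) (∑-cong (λ y → 𝟙-∧ (b x) (b y)) xs) ⟩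
  (∑[ y ∈ xs ] 𝟙 (b x) * 𝟙 (b y)) + count C 2        ≡⟨ cong (_+ count C 2) (∑-*ˡ (𝟙 (b x)) xs (𝟙 ∘ b)) ⟩
  𝟙 (b x) * count + count C 2                        ≡⟨ pascal (b x) ⟩
  (𝟙 (b x) + count) C 2                              ∎
  where
  open ≡-Reasoning
  f = λ xy → 𝟙 (b (proj₁ xy) ∧ b (proj₂ xy))
  count = ∑[ y ∈ xs ] 𝟙 (b y)
  pascal : ∀ c → 𝟙 c * count + count C 2 ≡ (𝟙 c + count) C 2
  pascal false = refl
  pascal true  = trans (cong (_+ count C 2) (trans (+-identityʳ count) (sym (nC1≡n count))))
                       (nCk+nC[k+1]≡[n+1]C[k+1] count 1)

All-pairsOf : ∀ {p} {P : Pred X p} {xs : List X} → Unique xs → All P xs →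
              All (λ xy → P (proj₁ xy) × P (proj₂ xy) × proj₁ xy ≢ proj₂ xy) (pairsOf xs)
All-pairsOf {xs = []}     _             _          = []
All-pairsOf {P = P} {xs = x ∷ xs} (x∉xs AllPairs.∷ u) (px ∷ pxs) =
  Allₚ.++⁺ (Allₚ.map⁺ (with-head x∉xs pxs)) (All-pairsOf u pxs)
  where
  with-head : ∀ {ys} → All (x ≢_) ys → All P ys → All (λ y → P x × P y × x ≢ y) ys
  with-head []           []         = []
  with-head (x≢y ∷ x≢ys) (py ∷ pys) = (px , py , x≢y) ∷ with-head x≢ys pys

-- Counting rows and matrices

allVecs-complete : ∀ {m} (r : Vec Bool m) → r ∈ allVecs m
allVecs-complete []      = here refl
allVecs-complete (b ∷ r) = ∈-concatMap⁺ _ (Any.map (λ { refl → head-or-next b }) (allVecs-complete r))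
  where
  head-or-next : ∀ b → b ∷ r ∈ (true ∷ r) ∷ (false ∷ r) ∷ []
  head-or-next true  = here refl
  head-or-next false = there (here refl)

∑-allVecs-suc : ∀ m (f : Vec Bool (suc m) → ℕ) →
                ∑ (allVecs (suc m)) f ≡ ∑[ r ∈ allVecs m ] (f (true ∷ r) + f (false ∷ r))
∑-allVecs-suc m f = trans (∑-concatMap _ (allVecs m) f)
  (∑-cong (λ r → cong (f (true ∷ r) +_) (+-identityʳ (f (false ∷ r)))) (allVecs m))

#rows : ∀ {m} → (Vec Bool m → Bool) → ℕ
#rows {m} q = ∑[ r ∈ allVecs m ] 𝟙 (q r)

allRows : ∀ {n m} → (Vec Bool m → Bool) → Matrix n m → Bool
allRows q []      = true
allRows q (r ∷ A) = q r ∧ allRows q A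

allRows-∧ : ∀ {n m} (q s : Vec Bool m → Bool) (A : Matrix n m) →
            allRows (λ r → q r ∧ s r) A ≡ allRows q A ∧ allRows s A
allRows-∧ q s []      = refl
allRows-∧ q s (r ∷ A) = begin
  (q r ∧ s r) ∧ allRows (λ r → q r ∧ s r) A ≡⟨ cong ((q r ∧ s r) ∧_) (allRows-∧ q s A) ⟩
  (q r ∧ s r) ∧ (allRows q A ∧ allRows s A) ≡⟨ ∧-interchange (q r) (s r) (allRows q A) (allRows s A) ⟩
  (q r ∧ allRows q A) ∧ (s r ∧ allRows s A) ∎
  where open ≡-Reasoning

∑-allRows : ∀ n {m} (q : Vec Bool m → Bool) → ∑[ A ∈ allMatrices n m ] 𝟙 (allRows q A) ≡ #rows q ^ n
∑-allRows zero    q = refl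
∑-allRows (suc n) {m} q = begin
  ∑ (concatMap (λ A → map (_∷ A) (allVecs m)) (allMatrices n m)) (𝟙 ∘ allRows q)
    ≡⟨ ∑-concatMap _ (allMatrices n m) _ ⟩
  ∑[ A ∈ allMatrices n m ] ∑ (map (_∷ A) (allVecs m)) (𝟙 ∘ allRows q)
    ≡⟨ ∑-cong (λ A → ∑-map (_∷ A) (allVecs m) _) (allMatrices n m) ⟩
  ∑[ A ∈ allMatrices n m ] ∑[ r ∈ allVecs m ] 𝟙 (q r ∧ allRows q A)
    ≡⟨ ∑-cong (λ A → trans (∑-cong (λ r → 𝟙-∧ (q r) (allRows q A)) (allVecs m))
                           (∑-*ʳ (𝟙 (allRows q A)) (allVecs m) (𝟙 ∘ q))) (allMatrices n m) ⟩
  ∑[ A ∈ allMatrices n m ] #rows q * 𝟙 (allRows q A)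
    ≡⟨ ∑-*ˡ (#rows q) (allMatrices n m) (𝟙 ∘ allRows q) ⟩
  #rows q * (∑[ A ∈ allMatrices n m ] 𝟙 (allRows q A))
    ≡⟨ cong (#rows q *_) (∑-allRows n q) ⟩
  #rows q ^ suc n ∎
  where open ≡-Reasoning

-- Coinciding columns

ColumnPair : ℕ → Set
ColumnPair m = Fin m × Fin m

Ordered : ∀ {m} → ColumnPair m → Set
Ordered (i , j) = i F.< j

ordered? : ∀ {m} → Decidable (Ordered {m})
ordered? (i , j) = i Finₚ.<? j

columnPairs : ∀ m → List (ColumnPair m)
columnPairs m = filter ordered? (cartesianProduct (List.allFin m) (List.allFin m))

columnPairs-ordered : ∀ m → All Ordered (columnPairs m)
columnPairs-ordered m = Allₚ.all-filter ordered? (cartesianProduct (List.allFin m) (List.allFin m))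

∈-columnPairs : ∀ {m} {i j : Fin m} → i F.< j → (i , j) ∈ columnPairs m
∈-columnPairs {i = i} {j} i<j = ∈-filter⁺ ordered? (∈-cartesianProduct⁺ (∈-allFin i) (∈-allFin j)) i<j

columnPairs-unique : ∀ m → Unique (columnPairs m)
columnPairs-unique m = Uniqueₚ.filter⁺ ordered? (Uniqueₚ.cartesianProduct⁺ (Uniqueₚ.allFin⁺ m) (Uniqueₚ.allFin⁺ m))

agreeAt : ∀ {m} → ColumnPair m → Vec Bool m → Bool
agreeAt (i , j) r = does (lookup r i Boolₚ.≟ lookup r j)

coincidences : ∀ {n m} → Matrix n m → ℕ
coincidences {m = m} A = ∑[ P ∈ columnPairs m ] 𝟙 (allRows (agreeAt P) A)

columnsEqual? : ∀ {n m} (i j : Fin m) (A : Matrix n m) → Dec (column A i ≡ column A j)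
columnsEqual? i j A = Vecₚ.≡-dec Boolₚ._≟_ (column A i) (column A j)

allRows-agreeAt : ∀ {n m} (i j : Fin m) (A : Matrix n m) →
                  allRows (agreeAt (i , j)) A ≡ does (columnsEqual? i j A)
allRows-agreeAt i j []      = refl
allRows-agreeAt i j (r ∷ A) = cong (does (lookup r i Boolₚ.≟ lookup r j) ∧_) (allRows-agreeAt i j A)

columnsDistinct⇔ : ∀ {n m} (A : Matrix n m) → ColumnsDistinct A ⇔ coincidences A ≡ 0
columnsDistinct⇔ {m = m} A = mk⇔ to from
  where
  differ : ∀ {i j} → column A i ≢ column A j → 𝟙 (allRows (agreeAt (i , j)) A) ≡ 0
  differ {i} {j} ≢ = cong 𝟙 (trans (allRows-agreeAt i j A) (dec-false (columnsEqual? i j A) ≢))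
  to : ColumnsDistinct A → coincidences A ≡ 0
  to distinct = trans (∑-const 0 (All.map (λ {(i , j)} i<j → differ (distinct′ i j (Finₚ.<⇒≢ i<j))) (columnPairs-ordered m)))
                      (*-zeroʳ (length (columnPairs m)))
    where
    distinct′ : ∀ i j → i ≢ j → column A i ≢ column A j
    distinct′ i j = VecAllₚ.tabulate⁻ (VecAllₚ.tabulate⁻ distinct i) j
  from : coincidences A ≡ 0 → ColumnsDistinct A
  from none = VecAllₚ.tabulate⁺ (λ i → VecAllₚ.tabulate⁺ (λ j → distinct′ i j))
    where
    ordered-differ : ∀ {i j} → i F.< j → column A i ≢ column A j
    ordered-differ {i} {j} i<j eq = 1+n≢0 (begin
      1                                   ≡⟨ cong 𝟙 (trans (allRows-agreeAt i j A) (dec-true (columnsEqual? i j A) eq)) ⟨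
      𝟙 (allRows (agreeAt (i , j)) A)     ≡⟨ ∑≡0⇒ (columnPairs m) none (∈-columnPairs i<j) ⟩
      0                                   ∎)
      where open ≡-Reasoning
    distinct′ : ∀ i j → i ≢ j → column A i ≢ column A j
    distinct′ i j i≢j with Finₚ.<-cmp i j
    ... | tri< i<j _ _ = ordered-differ i<j
    ... | tri≈ _ i≡j _ = contradiction i≡j i≢j
    ... | tri> _ _ j<i = ordered-differ j<i ∘ sym

-- verbatim the decider of ColumnsDistinct inside admissible?
columnsDistinct? : ∀ {n m} (A : Matrix n m) → Dec (ColumnsDistinct A)
columnsDistinct? A = VecAll.all? (λ i → VecAll.all? (λ j →
  ¬? (i Finₚ.≟ j) →-dec ¬? (columnsEqual? i j A)) (Vec.allFin _)) (Vec.allFin _)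

balanced : ∀ {m} → ℕ → Vec Bool m → Bool
balanced k r = plusCount r ≡ᵇ k

allRows-balanced : ∀ {n m} k (A : Matrix n m) →
                   does (VecAll.all? (λ r → plusCount r ≟ k) A) ≡ allRows (balanced k) A
allRows-balanced k []      = refl
allRows-balanced k (r ∷ A) = cong (balanced k r ∧_) (allRows-balanced k A)

𝟙-admissible : ∀ {n} k (A : Matrix n (2 * k)) →
               𝟙 (does (admissible? k A)) ≡ 𝟙 (allRows (balanced k) A) * 𝟙 (coincidences A ≡ᵇ 0)
𝟙-admissible k A = trans (cong 𝟙 (cong₂ _∧_ (allRows-balanced k A) distinct≡))
                         (𝟙-∧ (allRows (balanced k) A) (coincidences A ≡ᵇ 0))
  where
  distinct≡ = does-⇔ (columnsDistinct⇔ A) (columnsDistinct? A) (coincidences A ≟ 0)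

M≡∑ : ∀ n k → M n k ≡ ∑[ A ∈ allMatrices n (2 * k) ] 𝟙 (allRows (balanced k) A) * 𝟙 (coincidences A ≡ᵇ 0)
M≡∑ n k = trans (length-filter (admissible? k) (allMatrices n (2 * k))) (∑-cong (𝟙-admissible k) (allMatrices n (2 * k)))

-- Bonferroni inequalities

module Bonferroni {X E : Set} (xs : List X) (w : X → ℕ) (events : List E) (occurs : E → X → Bool) where

  hits : X → ℕ
  hits x = ∑[ e ∈ events ] 𝟙 (occurs e x)

  avoiding : ℕ
  avoiding = ∑[ x ∈ xs ] w x * 𝟙 (hits x ≡ᵇ 0)

  weight : (X → Bool) → ℕ
  weight q = ∑[ x ∈ xs ] w x * 𝟙 (q x)

  lower : ∑ xs w ≤ avoiding + (∑[ e ∈ events ] weight (occurs e))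
  lower = begin
    ∑ xs w                                                       ≤⟨ ∑-mono-≤ pointwise xs ⟩
    ∑[ x ∈ xs ] (w x * 𝟙 (hits x ≡ᵇ 0) + w x * hits x)           ≡⟨ ∑-+ xs _ _ ⟩
    avoiding + (∑[ x ∈ xs ] w x * hits x)
      ≡⟨ cong (avoiding +_) (∑-comm-*ˡ events xs w (λ e x → 𝟙 (occurs e x))) ⟨
    avoiding + (∑[ e ∈ events ] weight (occurs e)) ∎
    where
    open ≤-Reasoning
    1≤ : ∀ h → 1 ≤ 𝟙 (h ≡ᵇ 0) + h
    1≤ zero    = ≤-refl
    1≤ (suc h) = s≤s z≤n
    pointwise : ∀ x → w x ≤ w x * 𝟙 (hits x ≡ᵇ 0) + w x * hits x
    pointwise x = begin
      w x                                 ≡⟨ *-identityʳ (w x) ⟨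
      w x * 1                             ≤⟨ *-monoʳ-≤ (w x) (1≤ (hits x)) ⟩
      w x * (𝟙 (hits x ≡ᵇ 0) + hits x)    ≡⟨ *-distribˡ-+ (w x) _ (hits x) ⟩
      w x * 𝟙 (hits x ≡ᵇ 0) + w x * hits x ∎

  upper : avoiding + (∑[ e ∈ events ] weight (occurs e))
          ≤ ∑ xs w + (∑[ ee ∈ pairsOf events ] weight (λ x → occurs (proj₁ ee) x ∧ occurs (proj₂ ee) x))
  upper = begin
    avoiding + (∑[ e ∈ events ] weight (occurs e))
      ≡⟨ cong (avoiding +_) (∑-comm-*ˡ events xs w (λ e x → 𝟙 (occurs e x))) ⟩
    avoiding + (∑[ x ∈ xs ] w x * hits x)   ≡⟨ ∑-+ xs _ _ ⟨
    ∑[ x ∈ xs ] (w x * 𝟙 (hits x ≡ᵇ 0) + w x * hits x)                ≤⟨ ∑-mono-≤ pointwise xs ⟩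
    ∑[ x ∈ xs ] (w x + w x * (hits x C 2))                             ≡⟨ ∑-+ xs _ _ ⟩
    ∑ xs w + (∑[ x ∈ xs ] w x * (hits x C 2))
      ≡⟨ cong (∑ xs w +_) (∑-cong (λ x → cong (w x *_) (∑-pairsOf events (λ e → occurs e x))) xs) ⟨
    ∑ xs w + (∑[ x ∈ xs ] w x * (∑[ ee ∈ pairsOf events ] 𝟙 (occurs (proj₁ ee) x ∧ occurs (proj₂ ee) x)))
      ≡⟨ cong (∑ xs w +_) (∑-comm-*ˡ (pairsOf events) xs w (λ ee x → 𝟙 (occurs (proj₁ ee) x ∧ occurs (proj₂ ee) x))) ⟨
    ∑ xs w + (∑[ ee ∈ pairsOf events ] weight (λ x → occurs (proj₁ ee) x ∧ occurs (proj₂ ee) x)) ∎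
    where
    open ≤-Reasoning
    ≤1+C2 : ∀ h → 𝟙 (h ≡ᵇ 0) + h ≤ 1 + h C 2
    ≤1+C2 0             = ≤-refl
    ≤1+C2 1             = ≤-refl
    ≤1+C2 (suc (suc h)) = begin
      2 + h                       ≤⟨ s≤s (s≤s (m≤m+n h _)) ⟩
      2 + (h + suc h C 2)         ≡⟨ cong (λ t → 1 + (t + suc h C 2)) (nC1≡n (suc h)) ⟨
      1 + (suc h C 1 + suc h C 2) ≡⟨ cong suc (nCk+nC[k+1]≡[n+1]C[k+1] (suc h) 1) ⟩
      1 + suc (suc h) C 2         ∎
    pointwise : ∀ x → w x * 𝟙 (hits x ≡ᵇ 0) + w x * hits x ≤ w x + w x * (hits x C 2)
    pointwise x = begin
      w x * 𝟙 (hits x ≡ᵇ 0) + w x * hits x  ≡⟨ *-distribˡ-+ (w x) _ (hits x) ⟨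
      w x * (𝟙 (hits x ≡ᵇ 0) + hits x)      ≤⟨ *-monoʳ-≤ (w x) (≤1+C2 (hits x)) ⟩
      w x * (1 + hits x C 2)                ≡⟨ *-distribˡ-+ (w x) 1 _ ⟩
      w x * 1 + w x * (hits x C 2)          ≡⟨ cong (_+ w x * (hits x C 2)) (*-identityʳ (w x)) ⟩
      w x + w x * (hits x C 2)              ∎

∑-allRows-∧ : ∀ n {m} (q s : Vec Bool m → Bool) →
              ∑[ A ∈ allMatrices n m ] 𝟙 (allRows q A) * 𝟙 (allRows s A) ≡ #rows (λ r → q r ∧ s r) ^ n
∑-allRows-∧ n {m} q s = trans (∑-cong (λ A → sym (trans (cong 𝟙 (allRows-∧ q s A)) (𝟙-∧ (allRows q A) (allRows s A))))
                                  (allMatrices n m))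
                          (∑-allRows n (λ r → q r ∧ s r))

#balanced : ℕ → ℕ → ℕ
#balanced m k = #rows {m} (balanced k)

rowsAgreeing : ∀ {m} → ℕ → ColumnPair m → ℕ
rowsAgreeing k P = #rows (λ r → balanced k r ∧ agreeAt P r)

rowsAgreeingBoth : ∀ {m} → ℕ → ColumnPair m × ColumnPair m → ℕ
rowsAgreeingBoth k (P , Q) = #rows (λ r → balanced k r ∧ (agreeAt P r ∧ agreeAt Q r))

module _ (n k : ℕ) where
  private
    m = 2 * k
  open Bonferroni (allMatrices n m) (λ A → 𝟙 (allRows (balanced k) A)) (columnPairs m) (λ P A → allRows (agreeAt P) A)

  private
    balanced-weight : ∑[ A ∈ allMatrices n m ] 𝟙 (allRows (balanced k) A) ≡ #balanced m k ^ n
    balanced-weight = ∑-allRows n (balanced k)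

    agreeing-weight : ∀ P → weight (allRows (agreeAt P)) ≡ rowsAgreeing k P ^ n
    agreeing-weight P = ∑-allRows-∧ n (balanced k) (agreeAt P)

    agreeing-both-weight : ∀ PQ → weight (λ A → allRows (agreeAt (proj₁ PQ)) A ∧ allRows (agreeAt (proj₂ PQ)) A)
                                  ≡ rowsAgreeingBoth k PQ ^ n
    agreeing-both-weight (P , Q) = trans (∑-cong (λ A → cong (λ b → 𝟙 (allRows (balanced k) A) * 𝟙 b)
                                                              (sym (allRows-∧ (agreeAt P) (agreeAt Q) A)))
                                                 (allMatrices n m))
                                         (∑-allRows-∧ n (balanced k) (λ r → agreeAt P r ∧ agreeAt Q r))

  M-bonferroni-lower : #balanced m k ^ n ≤ M n k + (∑[ P ∈ columnPairs m ] rowsAgreeing k P ^ n)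
  M-bonferroni-lower = begin
    #balanced m k ^ n                                      ≡⟨ balanced-weight ⟨
    ∑[ A ∈ allMatrices n m ] 𝟙 (allRows (balanced k) A)    ≤⟨ lower ⟩
    avoiding + (∑[ P ∈ columnPairs m ] weight (allRows (agreeAt P)))
      ≡⟨ cong₂ _+_ (sym (M≡∑ n k)) (∑-cong agreeing-weight (columnPairs m)) ⟩
    M n k + (∑[ P ∈ columnPairs m ] rowsAgreeing k P ^ n)  ∎
    where open ≤-Reasoning

  M-bonferroni-upper : M n k + (∑[ P ∈ columnPairs m ] rowsAgreeing k P ^ n)
                       ≤ #balanced m k ^ n + (∑[ PQ ∈ pairsOf (columnPairs m) ] rowsAgreeingBoth k PQ ^ n)
  M-bonferroni-upper = begin
    M n k + (∑[ P ∈ columnPairs m ] rowsAgreeing k P ^ n)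
      ≡⟨ cong₂ _+_ (sym (M≡∑ n k)) (∑-cong agreeing-weight (columnPairs m)) ⟨
    avoiding + (∑[ P ∈ columnPairs m ] weight (allRows (agreeAt P)))    ≤⟨ upper ⟩
    (∑[ A ∈ allMatrices n m ] 𝟙 (allRows (balanced k) A))
      + (∑[ PQ ∈ pairsOf (columnPairs m) ] weight (λ A → allRows (agreeAt (proj₁ PQ)) A ∧ allRows (agreeAt (proj₂ PQ)) A))
      ≡⟨ cong₂ _+_ balanced-weight (∑-cong agreeing-both-weight (pairsOf (columnPairs m))) ⟩
    #balanced m k ^ n + (∑[ PQ ∈ pairsOf (columnPairs m) ] rowsAgreeingBoth k PQ ^ n) ∎
    where open ≤-Reasoning

-- Rows with prescribed entries

module _ {A : Set} (p : A → Bool) where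

  countᵇ-∷ : ∀ {n} x (xs : Vec A n) → countᵇ p (x ∷ xs) ≡ 𝟙 (p x) + countᵇ p xs
  countᵇ-∷ x xs with p x
  ... | true  = refl
  ... | false = refl

  countᵇ-replicate : ∀ n x → countᵇ p (replicate n x) ≡ n * 𝟙 (p x)
  countᵇ-replicate zero    x = refl
  countᵇ-replicate (suc n) x = trans (countᵇ-∷ x (replicate n x)) (cong (𝟙 (p x) +_) (countᵇ-replicate n x))

  countᵇ-[]≔ : ∀ {n} (xs : Vec A n) i y →
               countᵇ p (xs [ i ]≔ y) + 𝟙 (p (lookup xs i)) ≡ countᵇ p xs + 𝟙 (p y)
  countᵇ-[]≔ (x ∷ xs) zero y = begin
    countᵇ p (y ∷ xs) + 𝟙 (p x)          ≡⟨ cong (_+ 𝟙 (p x)) (countᵇ-∷ y xs) ⟩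
    𝟙 (p y) + countᵇ p xs + 𝟙 (p x)      ≡⟨ +-rotate (𝟙 (p y)) _ (𝟙 (p x)) ⟩
    𝟙 (p x) + countᵇ p xs + 𝟙 (p y)      ≡⟨ cong (_+ 𝟙 (p y)) (countᵇ-∷ x xs) ⟨
    countᵇ p (x ∷ xs) + 𝟙 (p y)          ∎
    where open ≡-Reasoning
  countᵇ-[]≔ (x ∷ xs) (suc i) y = begin
    countᵇ p (x ∷ (xs [ i ]≔ y)) + 𝟙 (p (lookup xs i))
      ≡⟨ cong (_+ 𝟙 (p (lookup xs i))) (countᵇ-∷ x (xs [ i ]≔ y)) ⟩
    𝟙 (p x) + countᵇ p (xs [ i ]≔ y) + 𝟙 (p (lookup xs i))
      ≡⟨ +-assoc (𝟙 (p x)) _ _ ⟩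
    𝟙 (p x) + (countᵇ p (xs [ i ]≔ y) + 𝟙 (p (lookup xs i)))
      ≡⟨ cong (𝟙 (p x) +_) (countᵇ-[]≔ xs i y) ⟩
    𝟙 (p x) + (countᵇ p xs + 𝟙 (p y))
      ≡⟨ +-assoc (𝟙 (p x)) _ _ ⟨
    𝟙 (p x) + countᵇ p xs + 𝟙 (p y)
      ≡⟨ cong (_+ 𝟙 (p y)) (countᵇ-∷ x xs) ⟨
    countᵇ p (x ∷ xs) + 𝟙 (p y) ∎
    where open ≡-Reasoning

  countᵇ-[]≔-≤ : ∀ {n} (xs : Vec A n) i y → countᵇ p (xs [ i ]≔ y) ≤ countᵇ p xs + 𝟙 (p y)
  countᵇ-[]≔-≤ xs i y = ≤-trans (m≤m+n _ _) (≤-reflexive (countᵇ-[]≔ xs i y))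
lookup∘update-preserves : ∀ {A : Set} {n} (xs : Vec A n) {i j} {x} →
                          lookup xs j ≡ x → lookup (xs [ i ]≔ x) j ≡ x
lookup∘update-preserves xs {i} {j} {x} xs[j]≡x with i Finₚ.≟ j
... | yes refl = Vecₚ.lookup∘update i xs x
... | no  i≢j  = trans (Vecₚ.lookup∘update′ (i≢j ∘ sym) xs x) xs[j]≡x

Pattern : ℕ → Set
Pattern m = Vec (Maybe Bool) m

unconstrained : ∀ {m} → Pattern m
unconstrained = replicate _ nothing

fits : ∀ {m} → Pattern m → Vec Bool m → Bool
fits []           []      = true
fits (nothing ∷ g) (b ∷ r) = fits g r
fits (just c ∷ g)  (b ∷ r) = does (c Boolₚ.≟ b) ∧ fits g r

isOne isFree isZero : Maybe Bool → Bool
isOne (just b)  = b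
isOne nothing   = false
isFree (just _) = false
isFree nothing  = true
isZero (just b) = not b
isZero nothing  = false

#ones #free #zeros : ∀ {m} → Pattern m → ℕ
#ones  = countᵇ isOne
#free  = countᵇ isFree
#zeros = countᵇ isZero

-- f C (k ∸ t) if t ≤ k, else 0: the ways to fill f free entries so that, together with
-- t entries pinned to 1, exactly k entries are 1
placements : (free ones k : ℕ) → ℕ
placements f zero    k       = f C k
placements f (suc t) zero    = 0
placements f (suc t) (suc k) = placements f t k

placements-suc-zero : ∀ f t → placements (suc f) t 0 ≡ placements f t 0
placements-suc-zero f zero    = refl
placements-suc-zero f (suc t) = refl

placements-pascal : ∀ f t k → placements (suc f) t (suc k) ≡ placements f t k + placements f t (suc k)
placements-pascal f zero    k       = sym (nCk+nC[k+1]≡[n+1]C[k+1] f k)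
placements-pascal f (suc t) zero    = placements-suc-zero f t
placements-pascal f (suc t) (suc k) = placements-pascal f t k

∑-fits-balanced : ∀ {m} (g : Pattern m) k →
                  ∑[ r ∈ allVecs m ] 𝟙 (fits g r ∧ balanced k r) ≡ placements (#free g) (#ones g) k
∑-fits-balanced []            zero    = refl
∑-fits-balanced []            (suc k) = refl
∑-fits-balanced {suc m} (nothing ∷ g) zero = begin
  ∑ (allVecs (suc m)) (λ r → 𝟙 (fits (nothing ∷ g) r ∧ balanced 0 r))
    ≡⟨ ∑-allVecs-suc m _ ⟩
  ∑[ r ∈ allVecs m ] (𝟙 (fits g r ∧ false) + 𝟙 (fits g r ∧ balanced 0 r))
    ≡⟨ ∑-cong (λ r → cong (λ b → 𝟙 b + 𝟙 (fits g r ∧ balanced 0 r)) (Boolₚ.∧-zeroʳ (fits g r))) (allVecs m) ⟩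
  ∑[ r ∈ allVecs m ] 𝟙 (fits g r ∧ balanced 0 r)
    ≡⟨ ∑-fits-balanced g zero ⟩
  placements (#free g) (#ones g) 0
    ≡⟨ placements-suc-zero (#free g) (#ones g) ⟨
  placements (suc (#free g)) (#ones g) 0 ∎
  where open ≡-Reasoning
∑-fits-balanced {suc m} (nothing ∷ g) (suc k) = begin
  ∑ (allVecs (suc m)) (λ r → 𝟙 (fits (nothing ∷ g) r ∧ balanced (suc k) r))
    ≡⟨ ∑-allVecs-suc m _ ⟩
  ∑[ r ∈ allVecs m ] (𝟙 (fits g r ∧ balanced k r) + 𝟙 (fits g r ∧ balanced (suc k) r))
    ≡⟨ ∑-+ (allVecs m) _ _ ⟩
  (∑[ r ∈ allVecs m ] 𝟙 (fits g r ∧ balanced k r)) + (∑[ r ∈ allVecs m ] 𝟙 (fits g r ∧ balanced (suc k) r))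
    ≡⟨ cong₂ _+_ (∑-fits-balanced g k) (∑-fits-balanced g (suc k)) ⟩
  placements (#free g) (#ones g) k + placements (#free g) (#ones g) (suc k)
    ≡⟨ placements-pascal (#free g) (#ones g) k ⟨
  placements (suc (#free g)) (#ones g) (suc k) ∎
  where open ≡-Reasoning
∑-fits-balanced {suc m} (just true ∷ g) zero = begin
  ∑ (allVecs (suc m)) (λ r → 𝟙 (fits (just true ∷ g) r ∧ balanced 0 r))
    ≡⟨ ∑-allVecs-suc m _ ⟩
  ∑[ r ∈ allVecs m ] (𝟙 (fits g r ∧ false) + 0)
    ≡⟨ ∑-cong (λ r → cong (λ b → 𝟙 b + 0) (Boolₚ.∧-zeroʳ (fits g r))) (allVecs m) ⟩
  ∑[ r ∈ allVecs m ] 0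
    ≡⟨ ∑-zero (allVecs m) ⟩
  0 ∎
  where open ≡-Reasoning
∑-fits-balanced {suc m} (just true ∷ g) (suc k) =
  trans (∑-allVecs-suc m _) (trans (∑-cong (λ r → +-identityʳ _) (allVecs m)) (∑-fits-balanced g k))
∑-fits-balanced {suc m} (just false ∷ g) k =
  trans (∑-allVecs-suc m _) (∑-fits-balanced g k)

balanced-completion : ∀ {m} (g : Pattern m) k → #ones g ≤ k → k ≤ #ones g + #free g →
                       ∃[ r ] fits g r ≡ true × balanced k r ≡ true
balanced-completion []            zero    _ _  = [] , refl , refl
balanced-completion []            (suc k) _ ()
balanced-completion (nothing ∷ g) k o≤k k≤ with k ≤? #ones g + #free g
... | yes k≤o+f = Product.map (false ∷_) id (balanced-completion g k o≤k k≤o+f)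
balanced-completion (nothing ∷ g) zero    _   _  | no k≰o+f = contradiction z≤n k≰o+f
balanced-completion (nothing ∷ g) (suc k) o≤k k≤ | no k≰o+f =
  Product.map (true ∷_) id (balanced-completion g k o≤k′ k≤o+f)
  where
  k≤o+f : k ≤ #ones g + #free g
  k≤o+f = ≤-pred (subst (suc k ≤_) (+-suc (#ones g) (#free g)) k≤)
  o≤k′ : #ones g ≤ k
  o≤k′ = ≤-pred (≤-trans (s≤s (m≤m+n (#ones g) (#free g))) (≰⇒> k≰o+f))
balanced-completion (just true ∷ g) (suc k) (s≤s o≤k) (s≤s k≤) =
  Product.map (true ∷_) id (balanced-completion g k o≤k k≤)
balanced-completion (just false ∷ g) k o≤k k≤ =
  Product.map (false ∷_) id (balanced-completion g k o≤k k≤)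

#ones+#free+#zeros : ∀ {m} (g : Pattern m) → #ones g + #free g + #zeros g ≡ m
#ones+#free+#zeros []               = refl
#ones+#free+#zeros (nothing ∷ g)    =
  trans (cong (_+ #zeros g) (+-suc (#ones g) (#free g))) (cong suc (#ones+#free+#zeros g))
#ones+#free+#zeros (just true ∷ g)  = cong suc (#ones+#free+#zeros g)
#ones+#free+#zeros (just false ∷ g) =
  trans (+-suc (#ones g + #free g) (#zeros g)) (cong suc (#ones+#free+#zeros g))

fits-unconstrained : ∀ {m} (r : Vec Bool m) → fits unconstrained r ≡ true
fits-unconstrained []      = refl
fits-unconstrained (b ∷ r) = fits-unconstrained r

fits-[]≔ : ∀ {m} (g : Pattern m) i c (r : Vec Bool m) → lookup g i ≡ nothing →
           fits (g [ i ]≔ just c) r ≡ does (c Boolₚ.≟ lookup r i) ∧ fits g r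
fits-[]≔ (nothing ∷ g) zero    c (b ∷ r) refl = refl
fits-[]≔ (nothing ∷ g) (suc i) c (b ∷ r) free = fits-[]≔ g i c r free
fits-[]≔ (just d ∷ g)  (suc i) c (b ∷ r) free =
  trans (cong (does (d Boolₚ.≟ b) ∧_) (fits-[]≔ g i c r free))
        (∧-left-comm (does (d Boolₚ.≟ b)) (does (c Boolₚ.≟ lookup r i)) (fits g r))

fits⇒lookup : ∀ {m} (g : Pattern m) r x {c} → fits g r ≡ true → lookup g x ≡ just c → lookup r x ≡ c
fits⇒lookup (nothing ∷ g)    (b ∷ r)     (suc x) fit g[x]≡c = fits⇒lookup g r x fit g[x]≡c
fits⇒lookup (just true ∷ g)  (true ∷ r)  zero    _   refl    = refl
fits⇒lookup (just false ∷ g) (false ∷ r) zero    _   refl    = refl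
fits⇒lookup (just true ∷ g)  (true ∷ r)  (suc x) fit g[x]≡c = fits⇒lookup g r x fit g[x]≡c
fits⇒lookup (just false ∷ g) (false ∷ r) (suc x) fit g[x]≡c = fits⇒lookup g r x fit g[x]≡c

#ones-unconstrained : ∀ m → #ones (unconstrained {m}) ≡ 0
#ones-unconstrained m = trans (countᵇ-replicate isOne m nothing) (*-zeroʳ m)

#zeros-unconstrained : ∀ m → #zeros (unconstrained {m}) ≡ 0
#zeros-unconstrained m = trans (countᵇ-replicate isZero m nothing) (*-zeroʳ m)

balanced-completion′ : ∀ {m} (g : Pattern m) k → #ones g ≤ k → k + #zeros g ≤ m →
                        ∃[ r ] fits g r ≡ true × balanced k r ≡ true
balanced-completion′ {m} g k o≤k k+z≤m = balanced-completion g k o≤k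
  (+-cancelʳ-≤ (#zeros g) k _ (≤-trans k+z≤m (≤-reflexive (sym (#ones+#free+#zeros g)))))

balanced-row-with-one-and-zero : ∀ {m} k (i j : Fin m) → i ≢ j → 1 ≤ k → k < m →
  ∃[ r ] balanced k r ≡ true × lookup r i ≡ true × lookup r j ≡ false
balanced-row-with-one-and-zero {m} k i j i≢j 1≤k k<m =
  read-off (balanced-completion′ g k ones≤k (≤-trans (+-monoʳ-≤ k zeros≤1) (subst (_≤ m) (+-comm 1 k) k<m)))
  where
  h = unconstrained [ j ]≔ just false
  g = h [ i ]≔ just true
  ones≤k : #ones g ≤ k
  ones≤k = begin
    #ones g         ≤⟨ countᵇ-[]≔-≤ isOne h i (just true) ⟩
    #ones h + 1     ≤⟨ +-monoˡ-≤ 1 (countᵇ-[]≔-≤ isOne unconstrained j (just false)) ⟩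
    #ones (unconstrained {m}) + 0 + 1 ≡⟨ cong (λ o → o + 0 + 1) (#ones-unconstrained m) ⟩
    1               ≤⟨ 1≤k ⟩
    k               ∎
    where open ≤-Reasoning
  zeros≤1 : #zeros g ≤ 1
  zeros≤1 = begin
    #zeros g        ≤⟨ countᵇ-[]≔-≤ isZero h i (just true) ⟩
    #zeros h + 0    ≤⟨ +-monoˡ-≤ 0 (countᵇ-[]≔-≤ isZero unconstrained j (just false)) ⟩
    #zeros (unconstrained {m}) + 1 + 0 ≡⟨ cong (λ z → z + 1 + 0) (#zeros-unconstrained m) ⟩
    1               ∎
    where open ≤-Reasoning
  read-off : ∃[ r ] fits g r ≡ true × balanced k r ≡ true →
             ∃[ r ] balanced k r ≡ true × lookup r i ≡ true × lookup r j ≡ false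
  read-off (r , fit , bal) =
    r , bal , fits⇒lookup g r i fit (Vecₚ.lookup∘update i h (just true))
            , fits⇒lookup g r j fit (trans (Vecₚ.lookup∘update′ (i≢j ∘ sym) h (just true))
                                           (Vecₚ.lookup∘update j unconstrained (just false)))

balanced-row-with-three-ones-and-zero : ∀ {m} k (i j z w : Fin m) → w ≢ i → w ≢ j → w ≢ z → 3 ≤ k → k < m →
  ∃[ r ] balanced k r ≡ true × lookup r i ≡ true × lookup r j ≡ true × lookup r z ≡ true × lookup r w ≡ false
balanced-row-with-three-ones-and-zero {m} k i j z w w≢i w≢j w≢z 3≤k k<m =
  read-off (balanced-completion′ g k ones≤k (≤-trans (+-monoʳ-≤ k zeros≤1) (subst (_≤ m) (+-comm 1 k) k<m)))
  where
  h₁ = unconstrained [ w ]≔ just false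
  h₂ = h₁ [ i ]≔ just true
  h₃ = h₂ [ j ]≔ just true
  g  = h₃ [ z ]≔ just true
  ones≤k : #ones g ≤ k
  ones≤k = begin
    #ones g                 ≤⟨ countᵇ-[]≔-≤ isOne h₃ z (just true) ⟩
    #ones h₃ + 1            ≤⟨ +-monoˡ-≤ 1 (countᵇ-[]≔-≤ isOne h₂ j (just true)) ⟩
    #ones h₂ + 1 + 1        ≤⟨ +-monoˡ-≤ 1 (+-monoˡ-≤ 1 (countᵇ-[]≔-≤ isOne h₁ i (just true))) ⟩
    #ones h₁ + 1 + 1 + 1
      ≤⟨ +-monoˡ-≤ 1 (+-monoˡ-≤ 1 (+-monoˡ-≤ 1 (countᵇ-[]≔-≤ isOne unconstrained w (just false)))) ⟩
    #ones (unconstrained {m}) + 0 + 1 + 1 + 1 ≡⟨ cong (λ o → o + 0 + 1 + 1 + 1) (#ones-unconstrained m) ⟩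
    3                       ≤⟨ 3≤k ⟩
    k                       ∎
    where open ≤-Reasoning
  zeros≤1 : #zeros g ≤ 1
  zeros≤1 = begin
    #zeros g                ≤⟨ countᵇ-[]≔-≤ isZero h₃ z (just true) ⟩
    #zeros h₃ + 0           ≤⟨ +-monoˡ-≤ 0 (countᵇ-[]≔-≤ isZero h₂ j (just true)) ⟩
    #zeros h₂ + 0 + 0       ≤⟨ +-monoˡ-≤ 0 (+-monoˡ-≤ 0 (countᵇ-[]≔-≤ isZero h₁ i (just true))) ⟩
    #zeros h₁ + 0 + 0 + 0
      ≤⟨ +-monoˡ-≤ 0 (+-monoˡ-≤ 0 (+-monoˡ-≤ 0 (countᵇ-[]≔-≤ isZero unconstrained w (just false)))) ⟩
    #zeros (unconstrained {m}) + 1 + 0 + 0 + 0 ≡⟨ cong (λ o → o + 1 + 0 + 0 + 0) (#zeros-unconstrained m) ⟩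
    1                       ∎
    where open ≤-Reasoning
  read-off : ∃[ r ] fits g r ≡ true × balanced k r ≡ true →
             ∃[ r ] balanced k r ≡ true × lookup r i ≡ true × lookup r j ≡ true × lookup r z ≡ true × lookup r w ≡ false
  read-off (r , fit , bal) =
    r , bal , fits⇒lookup g r i fit
                  (lookup∘update-preserves h₃ (lookup∘update-preserves h₂ (Vecₚ.lookup∘update i h₁ (just true))))
            , fits⇒lookup g r j fit (lookup∘update-preserves h₃ (Vecₚ.lookup∘update j h₂ (just true)))
            , fits⇒lookup g r z fit (Vecₚ.lookup∘update z h₃ (just true))
            , fits⇒lookup g r w fit (begin
                lookup g w             ≡⟨ Vecₚ.lookup∘update′ w≢z h₃ (just true) ⟩
                lookup h₃ w            ≡⟨ Vecₚ.lookup∘update′ w≢j h₂ (just true) ⟩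
                lookup h₂ w            ≡⟨ Vecₚ.lookup∘update′ w≢i h₁ (just true) ⟩
                lookup h₁ w            ≡⟨ Vecₚ.lookup∘update w unconstrained (just false) ⟩
                just false             ∎)
    where open ≡-Reasoning

-- Balanced rows agreeing on column pairs

-- the two positions are both 1, or both 0
#agreeing : ℕ → ℕ → ℕ
#agreeing m k = placements (m ∸ 2) 2 k + placements (m ∸ 2) 0 k

pinnedPair : ∀ {m} → Fin m → Fin m → Bool → Pattern m
pinnedPair i j c = unconstrained [ j ]≔ just c [ i ]≔ just c

module _ {m} {i j : Fin m} (i≢j : i ≢ j) where

  private
    unpinned-i : ∀ c → lookup (unconstrained [ j ]≔ just c) i ≡ nothing
    unpinned-i c = trans (Vecₚ.lookup∘update′ i≢j unconstrained (just c)) (Vecₚ.lookup-replicate i nothing)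

  fits-pinnedPair : ∀ c r → fits (pinnedPair i j c) r ≡ does (c Boolₚ.≟ lookup r i) ∧ (does (c Boolₚ.≟ lookup r j) ∧ true)
  fits-pinnedPair c r = trans (fits-[]≔ (unconstrained [ j ]≔ just c) i c r (unpinned-i c))
    (cong (does (c Boolₚ.≟ lookup r i) ∧_)
          (trans (fits-[]≔ unconstrained j c r (Vecₚ.lookup-replicate j nothing))
                 (cong (does (c Boolₚ.≟ lookup r j) ∧_) (fits-unconstrained r))))

  countᵇ-pinnedPair : ∀ p c → countᵇ p (pinnedPair i j c) + 𝟙 (p nothing) + 𝟙 (p nothing)
                              ≡ m * 𝟙 (p nothing) + 𝟙 (p (just c)) + 𝟙 (p (just c))
  countᵇ-pinnedPair p c = begin
    countᵇ p (pinnedPair i j c) + 𝟙 (p nothing) + 𝟙 (p nothing)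
      ≡⟨ cong (λ x → countᵇ p (pinnedPair i j c) + 𝟙 (p x) + 𝟙 (p nothing)) (unpinned-i c) ⟨
    countᵇ p (pinnedPair i j c) + 𝟙 (p (lookup h i)) + 𝟙 (p nothing)
      ≡⟨ cong (_+ 𝟙 (p nothing)) (countᵇ-[]≔ p h i (just c)) ⟩
    countᵇ p h + 𝟙 (p (just c)) + 𝟙 (p nothing)
      ≡⟨ +-right-comm (countᵇ p h) _ _ ⟩
    countᵇ p h + 𝟙 (p nothing) + 𝟙 (p (just c))
      ≡⟨ cong (λ x → countᵇ p h + 𝟙 (p x) + 𝟙 (p (just c))) (Vecₚ.lookup-replicate j nothing) ⟨
    countᵇ p h + 𝟙 (p (lookup unconstrained j)) + 𝟙 (p (just c))
      ≡⟨ cong (_+ 𝟙 (p (just c))) (countᵇ-[]≔ p unconstrained j (just c)) ⟩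
    countᵇ p (unconstrained {m}) + 𝟙 (p (just c)) + 𝟙 (p (just c))
      ≡⟨ cong (λ x → x + 𝟙 (p (just c)) + 𝟙 (p (just c))) (countᵇ-replicate p m nothing) ⟩
    m * 𝟙 (p nothing) + 𝟙 (p (just c)) + 𝟙 (p (just c)) ∎
    where
    open ≡-Reasoning
    h = unconstrained [ j ]≔ just c

  #free-pinnedPair : ∀ c → #free (pinnedPair i j c) ≡ m ∸ 2
  #free-pinnedPair c = begin
    #free (pinnedPair i j c)                  ≡⟨ m+n∸n≡m (#free (pinnedPair i j c)) 2 ⟨
    #free (pinnedPair i j c) + 2 ∸ 2          ≡⟨ cong (_∸ 2) (sym (+-assoc (#free (pinnedPair i j c)) 1 1)) ⟩
    #free (pinnedPair i j c) + 1 + 1 ∸ 2      ≡⟨ cong (_∸ 2) (countᵇ-pinnedPair isFree c) ⟩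
    m * 1 + 0 + 0 ∸ 2                         ≡⟨ cong (_∸ 2) (trans (+-identityʳ _) (trans (+-identityʳ _) (*-identityʳ m))) ⟩
    m ∸ 2                                     ∎
    where open ≡-Reasoning

  #ones-pinnedPair : ∀ c → #ones (pinnedPair i j c) ≡ 2 * 𝟙 c
  #ones-pinnedPair c = begin
    #ones (pinnedPair i j c)                  ≡⟨ trans (+-identityʳ _) (+-identityʳ _) ⟨
    #ones (pinnedPair i j c) + 0 + 0          ≡⟨ countᵇ-pinnedPair isOne c ⟩
    m * 0 + 𝟙 c + 𝟙 c                         ≡⟨ cong (λ x → x + 𝟙 c + 𝟙 c) (*-zeroʳ m) ⟩
    𝟙 c + 𝟙 c                                 ≡⟨ cong (𝟙 c +_) (+-identityʳ (𝟙 c)) ⟨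
    2 * 𝟙 c                                   ∎
    where open ≡-Reasoning

agreeAt-split : ∀ {m} (i j : Fin m) {s} (r : Vec Bool m) →
  𝟙 (s ∧ agreeAt (i , j) r) ≡ 𝟙 ((does (true Boolₚ.≟ lookup r i) ∧ (does (true Boolₚ.≟ lookup r j) ∧ true)) ∧ s)
                             + 𝟙 ((does (false Boolₚ.≟ lookup r i) ∧ (does (false Boolₚ.≟ lookup r j) ∧ true)) ∧ s)
agreeAt-split i j {s} r with lookup r i | lookup r j | s
... | true  | true  | true  = refl
... | true  | true  | false = refl
... | true  | false | true  = refl
... | true  | false | false = refl
... | false | true  | true  = refl
... | false | true  | false = refl
... | false | false | true  = refl
... | false | false | false = refl

rowsAgreeing≡ : ∀ {m} k (i j : Fin m) → i ≢ j → rowsAgreeing k (i , j) ≡ #agreeing m k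
rowsAgreeing≡ {m} k i j i≢j = begin
  ∑[ r ∈ allVecs m ] 𝟙 (balanced k r ∧ agreeAt (i , j) r)
    ≡⟨ ∑-cong split (allVecs m) ⟩
  ∑[ r ∈ allVecs m ] (𝟙 (fits (pinnedPair i j true) r ∧ balanced k r) + 𝟙 (fits (pinnedPair i j false) r ∧ balanced k r))
    ≡⟨ ∑-+ (allVecs m) _ _ ⟩
  (∑[ r ∈ allVecs m ] 𝟙 (fits (pinnedPair i j true) r ∧ balanced k r))
    + (∑[ r ∈ allVecs m ] 𝟙 (fits (pinnedPair i j false) r ∧ balanced k r))
    ≡⟨ cong₂ _+_ (∑-fits-balanced (pinnedPair i j true) k) (∑-fits-balanced (pinnedPair i j false) k) ⟩
  placements (#free (pinnedPair i j true)) (#ones (pinnedPair i j true)) k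
    + placements (#free (pinnedPair i j false)) (#ones (pinnedPair i j false)) k
    ≡⟨ cong₂ _+_ (counts true) (counts false) ⟩
  #agreeing m k ∎
  where
  open ≡-Reasoning
  split : ∀ r → 𝟙 (balanced k r ∧ agreeAt (i , j) r)
                ≡ 𝟙 (fits (pinnedPair i j true) r ∧ balanced k r) + 𝟙 (fits (pinnedPair i j false) r ∧ balanced k r)
  split r rewrite fits-pinnedPair i≢j true r | fits-pinnedPair i≢j false r = agreeAt-split i j r
  counts : ∀ c → placements (#free (pinnedPair i j c)) (#ones (pinnedPair i j c)) k ≡ placements (m ∸ 2) (2 * 𝟙 c) k
  counts c = cong₂ (λ f o → placements f o k) (#free-pinnedPair i≢j c) (#ones-pinnedPair i≢j c)

rowsAgreeing<#balanced : ∀ {m} k (i j : Fin m) → i ≢ j → 1 ≤ k → k < m →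
                         rowsAgreeing k (i , j) < #balanced m k
rowsAgreeing<#balanced {m} k i j i≢j 1≤k k<m with balanced-row-with-one-and-zero k i j i≢j 1≤k k<m
... | r , bal , rᵢ , rⱼ = ∑-mono-< (λ r → 𝟙-∧-≤ (balanced k r) (agreeAt (i , j) r)) (allVecs-complete r) disagree
  where
  disagree : 𝟙 (balanced k r ∧ agreeAt (i , j) r) < 𝟙 (balanced k r)
  disagree rewrite bal | rᵢ | rⱼ = s≤s z≤n

separating-index : ∀ {m} {P Q : ColumnPair m} → Ordered P → Ordered Q → P ≢ Q →
                   ∃[ w ] ∃[ z ] w ≢ proj₁ P × w ≢ proj₂ P × w ≢ z × (Q ≡ (w , z) ⊎ Q ≡ (z , w))
separating-index {P = i , j} {Q = u , v} i<j u<v P≢Q = cases (u Finₚ.≟ i) (u Finₚ.≟ j) (v Finₚ.≟ i) (v Finₚ.≟ j)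
  where
  cases : Dec (u ≡ i) → Dec (u ≡ j) → Dec (v ≡ i) → Dec (v ≡ j) →
          ∃[ w ] ∃[ z ] w ≢ i × w ≢ j × w ≢ z × ((u , v) ≡ (w , z) ⊎ (u , v) ≡ (z , w))
  cases (no u≢i)  (no u≢j)  _         _         = u , v , u≢i , u≢j , Finₚ.<⇒≢ u<v , inj₁ refl
  cases _         _         (no v≢i)  (no v≢j)  = v , u , v≢i , v≢j , Finₚ.<⇒≢ u<v ∘ sym , inj₂ refl
  cases (yes u≡i) _         (yes v≡i) _         = contradiction (trans u≡i (sym v≡i)) (Finₚ.<⇒≢ u<v)
  cases (yes u≡i) _         _         (yes v≡j) = contradiction (cong₂ _,_ u≡i v≡j) (P≢Q ∘ sym)
  cases _         (yes u≡j) (yes v≡i) _         = contradiction (subst₂ F._<_ u≡j v≡i u<v) (Finₚ.<-asym i<j)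
  cases _         (yes u≡j) _         (yes v≡j) = contradiction (trans u≡j (sym v≡j)) (Finₚ.<⇒≢ u<v)

-- The separating row has three ones besides the zero: this is where k ≥ 3 is needed.
rowsAgreeingBoth<rowsAgreeing : ∀ {m} k {P Q : ColumnPair m} → Ordered P → Ordered Q → P ≢ Q → 3 ≤ k → k < m →
                                rowsAgreeingBoth k (P , Q) < rowsAgreeing k P
rowsAgreeingBoth<rowsAgreeing {m} k {i , j} {Q} i<j ordQ P≢Q 3≤k k<m
  with separating-index i<j ordQ P≢Q
... | w , z , w≢i , w≢j , w≢z , Q≡ with balanced-row-with-three-ones-and-zero k i j z w w≢i w≢j w≢z 3≤k k<m
... | r , bal , rᵢ , rⱼ , r₌ , r≠ =
  ∑-mono-< (λ r → 𝟙-∧-∧-≤ (balanced k r) (agreeAt (i , j) r) (agreeAt Q r)) (allVecs-complete r) separated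
  where
  𝟙-∧-∧-≤ : ∀ a b c → 𝟙 (a ∧ (b ∧ c)) ≤ 𝟙 (a ∧ b)
  𝟙-∧-∧-≤ true  true  true  = ≤-refl
  𝟙-∧-∧-≤ true  true  false = z≤n
  𝟙-∧-∧-≤ true  false c     = z≤n
  𝟙-∧-∧-≤ false b     c     = z≤n
  disagree : ∀ {Q} → Q ≡ (w , z) ⊎ Q ≡ (z , w) → agreeAt Q r ≡ false
  disagree (inj₁ refl) rewrite r≠ | r₌ = refl
  disagree (inj₂ refl) rewrite r≠ | r₌ = refl
  separated : 𝟙 (balanced k r ∧ (agreeAt (i , j) r ∧ agreeAt Q r)) < 𝟙 (balanced k r ∧ agreeAt (i , j) r)
  separated rewrite bal | rᵢ | rⱼ | disagree Q≡ = s≤s z≤n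

-- Eventual log-concavity

bernoulli : ∀ b n → b ^ n * (b + n) ≤ b * suc b ^ n
bernoulli b zero    = ≤-reflexive (trans (+-identityʳ (b + 0)) (trans (+-identityʳ b) (sym (*-identityʳ b))))
bernoulli b (suc n) = begin
  b * b ^ n * (b + suc n)     ≡⟨ trans (cong (_* (b + suc n)) (*-comm b (b ^ n))) (*-assoc (b ^ n) b _) ⟩
  b ^ n * (b * (b + suc n))   ≤⟨ *-monoʳ-≤ (b ^ n) (≤-trans (m≤m+n _ n) (≤-reflexive (step b n))) ⟩
  b ^ n * (suc b * (b + n))   ≡⟨ *-left-comm (b ^ n) (suc b) (b + n) ⟩
  suc b * (b ^ n * (b + n))   ≤⟨ *-monoʳ-≤ (suc b) (bernoulli b n) ⟩
  suc b * (b * suc b ^ n)     ≡⟨ *-left-comm (suc b) b (suc b ^ n) ⟩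
  b * (suc b * suc b ^ n)     ∎
  where
  open ≤-Reasoning
  step : ∀ b n → b * (b + suc n) + n ≡ suc b * (b + n)
  step = solve-∀

pow-dominates : ∀ b c → ∃[ N ] (∀ n → N ≤ n → c * b ^ n < suc b ^ n)
pow-dominates zero    c = 1 , λ { (suc n) _ → ≤-reflexive (trans (cong suc (*-zeroʳ c)) (sym (^-zeroˡ (suc n)))) }
pow-dominates b@(suc _) c = suc (c * b) , λ n N≤n → *-cancelˡ-< b _ _ (begin-strict
  b * (c * b ^ n)        ≡⟨ trans (*-left-comm b c (b ^ n)) (trans (cong (c *_) (*-comm b (b ^ n))) (*-left-comm c (b ^ n) b)) ⟩
  b ^ n * (c * b)        <⟨ m<m+n (b ^ n * (c * b)) (m^n>0 b n) ⟩
  b ^ n * (c * b) + b ^ n ≡⟨ trans (*-suc (b ^ n) (c * b)) (+-comm (b ^ n) _) ⟨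
  b ^ n * suc (c * b)    ≤⟨ *-monoʳ-≤ (b ^ n) (≤-trans N≤n (m≤n+m n b)) ⟩
  b ^ n * (b + n)        ≤⟨ bernoulli b n ⟩
  b * suc b ^ n          ∎)
  where open ≤-Reasoning

-- Adding pA, paA, pa²A to x, y, z adds the same amount to both sides, because (paA)² = (pA)(pa²A).
log-concave-unshift : ∀ x y z p a A →
  (x + p * A) * (z + p * (a * (a * A))) + 2 * (p * (a * A)) * (y + p * (a * A))
    < (y + p * (a * A)) * (y + p * (a * A)) + p * (a * (a * A)) * (x + p * A) + p * A * (z + p * (a * (a * A)))
  → x * z < y * y
log-concave-unshift x y z p a A shifted =
  +-cancelʳ-< _ (x * z) (y * y) (subst₂ _<_ (lhs x y z p a A) (rhs x y z p a A) shifted)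
  where
  lhs : ∀ x y z p a A → (x + p * A) * (z + p * (a * (a * A))) + 2 * (p * (a * A)) * (y + p * (a * A))
        ≡ x * z + (x * (p * (a * (a * A))) + p * A * z + 2 * (p * (a * A)) * y + 3 * ((p * (a * A)) * (p * (a * A))))
  lhs = solve-∀
  rhs : ∀ x y z p a A → (y + p * (a * A)) * (y + p * (a * A)) + p * (a * (a * A)) * (x + p * A) + p * A * (z + p * (a * (a * A)))
        ≡ y * y + (x * (p * (a * (a * A))) + p * A * z + 2 * (p * (a * A)) * y + 3 * ((p * (a * A)) * (p * (a * A))))
  rhs = solve-∀

module _ (a b d p q : ℕ) where
  private
    T = a + d
    K = 2 * q + q * q + 2 * p * q

  -- Right side minus left side ≥ p d² A t − error, and error ≤ K T² B t < A t.
  shifted-log-concave : ∀ {t A B x y z} → 1 ≤ d → 1 ≤ p → 1 ≤ t → b ≤ a → A ≤ t → B ≤ t → K * (T * T) * B < A →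
    t ≤ x → x ≤ t + q * B →
    T * t ≤ y → y ≤ T * t + q * (b * B) →
    T * (T * t) ≤ z → z ≤ T * (T * t) + q * (b * (b * B)) →
    x * z + 2 * (p * (a * A)) * y < y * y + p * (a * (a * A)) * x + p * A * z
  shifted-log-concave {t} {A} {B} {x} {y} {z} 1≤d 1≤p 1≤t b≤a A≤t B≤t KT²B<A t≤x x≤ Tt≤y y≤ T²t≤z z≤ = begin-strict
    x * z + 2 * (p * (a * A)) * y         ≤⟨ +-mono-≤ (*-mono-≤ x≤ z≤) (*-monoʳ-≤ (2 * (p * (a * A))) y≤) ⟩
    upper                                 ≡⟨ upper≡ t A B a b d p q ⟩
    common + error                        <⟨ +-monoʳ-< common error<gain ⟩
    common + p * d * d * A * t            ≡⟨ lower≡ t A a d p ⟨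
    lower                                 ≤⟨ +-mono-≤ (+-mono-≤ (*-mono-≤ Tt≤y Tt≤y) (*-monoʳ-≤ (p * (a * (a * A))) t≤x))
                                                      (*-monoʳ-≤ (p * A) T²t≤z) ⟩
    y * y + p * (a * (a * A)) * x + p * A * z ∎
    where
    open ≤-Reasoning
    upper = (t + q * B) * (T * (T * t) + q * (b * (b * B))) + 2 * (p * (a * A)) * (T * t + q * (b * B))
    lower = (T * t) * (T * t) + p * (a * (a * A)) * t + p * A * (T * (T * t))
    common = (T * t) * (T * t) + 2 * p * A * a * T * t
    error = q * b * b * B * t + q * T * T * B * t + q * q * b * b * B * B + 2 * p * q * A * a * b * B

    upper≡ : ∀ t A B a b d p q →
      (t + q * B) * ((a + d) * ((a + d) * t) + q * (b * (b * B))) + 2 * (p * (a * A)) * ((a + d) * t + q * (b * B))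
      ≡ ((a + d) * t) * ((a + d) * t) + 2 * p * A * a * (a + d) * t
        + (q * b * b * B * t + q * (a + d) * (a + d) * B * t + q * q * b * b * B * B + 2 * p * q * A * a * b * B)
    upper≡ = solve-∀
    lower≡ : ∀ t A a d p →
      ((a + d) * t) * ((a + d) * t) + p * (a * (a * A)) * t + p * A * ((a + d) * ((a + d) * t))
      ≡ ((a + d) * t) * ((a + d) * t) + 2 * p * A * a * (a + d) * t + p * d * d * A * t
    lower≡ = solve-∀

    a≤T = m≤m+n a d
    b≤T = ≤-trans b≤a a≤T
    error≤ : error ≤ K * (T * T) * B * t
    error≤ = begin
      error ≤⟨ +-mono-≤ (+-mono-≤ (+-mono-≤ (*-monoˡ-≤ t (*-monoˡ-≤ B (*-mono-≤ (*-monoʳ-≤ q b≤T) b≤T))) ≤-refl)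
                                  (*-mono-≤ (*-monoˡ-≤ B (*-mono-≤ (*-monoʳ-≤ (q * q) b≤T) b≤T)) B≤t))
                       (*-monoˡ-≤ B (*-mono-≤ (*-mono-≤ (*-monoʳ-≤ (2 * p * q) A≤t) a≤T) b≤T)) ⟩
      q * T * T * B * t + q * T * T * B * t + q * q * T * T * B * t + 2 * p * q * t * T * T * B
        ≡⟨ collect t B T p q ⟩
      K * (T * T) * B * t ∎
      where
      collect : ∀ t B T p q → q * T * T * B * t + q * T * T * B * t + q * q * T * T * B * t + 2 * p * q * t * T * T * B
                              ≡ (2 * q + q * q + 2 * p * q) * (T * T) * B * t
      collect = solve-∀
    error<gain : error < p * d * d * A * t
    error<gain = begin-strict
      error                   ≤⟨ error≤ ⟩
      K * (T * T) * B * t     <⟨ *-monoˡ-< t {{>-nonZero 1≤t}} KT²B<A ⟩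
      A * t                   ≤⟨ m≤n*m (A * t) (p * d * d) {{>-nonZero (*-mono-≤ (*-mono-≤ 1≤p 1≤d) 1≤d)}} ⟩
      p * d * d * (A * t)     ≡⟨ *-assoc (p * d * d) A t ⟨
      p * d * d * A * t       ∎

eventually-log-concave : (f : ℕ → ℕ) (T a b p q : ℕ) → a ≡ suc b → a < T → 1 ≤ p →
  (∀ n → T ^ n ≤ f n + p * a ^ n) → (∀ n → f n + p * a ^ n ≤ T ^ n + q * b ^ n) →
  ∃[ N ] (∀ n → n ≥ N → n ≥ 1 → f (n ∸ 1) * f (suc n) < f n * f n)
eventually-log-concave f T a b p q refl a<T 1≤p lower upper = suc N , log-concave
  where
  d = T ∸ a
  T≡a+d : T ≡ a + d
  T≡a+d = sym (m+[n∸m]≡n (<⇒≤ a<T))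
  lower′ : ∀ n → (a + d) ^ n ≤ f n + p * a ^ n
  lower′ = subst (λ T → ∀ n → T ^ n ≤ f n + p * a ^ n) T≡a+d lower
  upper′ : ∀ n → f n + p * a ^ n ≤ (a + d) ^ n + q * b ^ n
  upper′ = subst (λ T → ∀ n → f n + p * a ^ n ≤ T ^ n + q * b ^ n) T≡a+d upper
  dominance = pow-dominates b ((2 * q + q * q + 2 * p * q) * ((a + d) * (a + d)))
  N = proj₁ dominance
  dominated = proj₂ dominance
  log-concave : ∀ n → n ≥ suc N → n ≥ 1 → f (n ∸ 1) * f (suc n) < f n * f n
  log-concave (suc n) (s≤s N≤n) _ = log-concave-unshift (f n) (f (suc n)) (f (suc (suc n))) p a (a ^ n)
    (shifted-log-concave a b d p q (m<n⇒0<n∸m a<T) 1≤p (m^n>0 (a + d) n) (n≤1+n b)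
      (^-monoˡ-≤ n (m≤m+n a d)) (^-monoˡ-≤ n (≤-trans (n≤1+n b) (m≤m+n a d))) (dominated n N≤n)
      (lower′ n) (upper′ n) (lower′ (suc n)) (upper′ (suc n)) (lower′ (suc (suc n))) (upper′ (suc (suc n))))

-- Bounds for M

k<2*k : ∀ {k} → 1 ≤ k → k < 2 * k
k<2*k {k} 1≤k = m<m+n k (≤-trans 1≤k (m≤m+n k 0))

∑-rowsAgreeing : ∀ m k n → ∑[ P ∈ columnPairs m ] rowsAgreeing k P ^ n ≡ length (columnPairs m) * #agreeing m k ^ n
∑-rowsAgreeing m k n = ∑-const (#agreeing m k ^ n)
  (All.map (λ {(i , j)} i<j → cong (_^ n) (rowsAgreeing≡ k i j (Finₚ.<⇒≢ i<j))) (columnPairs-ordered m))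

M-lower-bound : ∀ n k → #balanced (2 * k) k ^ n ≤ M n k + length (columnPairs (2 * k)) * #agreeing (2 * k) k ^ n
M-lower-bound n k = subst (λ s → #balanced (2 * k) k ^ n ≤ M n k + s) (∑-rowsAgreeing (2 * k) k n) (M-bonferroni-lower n k)

M-upper-bound : ∀ n k → 3 ≤ k →
  M n k + length (columnPairs (2 * k)) * #agreeing (2 * k) k ^ n
    ≤ #balanced (2 * k) k ^ n + length (pairsOf (columnPairs (2 * k))) * (#agreeing (2 * k) k ∸ 1) ^ n
M-upper-bound n k 3≤k = begin
  M n k + length (columnPairs m) * a ^ n
    ≡⟨ cong (M n k +_) (∑-rowsAgreeing m k n) ⟨
  M n k + (∑[ P ∈ columnPairs m ] rowsAgreeing k P ^ n)
    ≤⟨ M-bonferroni-upper n k ⟩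
  #balanced m k ^ n + (∑[ PQ ∈ pairsOf (columnPairs m) ] rowsAgreeingBoth k PQ ^ n)
    ≤⟨ +-monoʳ-≤ (#balanced m k ^ n) (∑-≤-const ((a ∸ 1) ^ n)
         (All.map both-bounded (All-pairsOf (columnPairs-unique m) (columnPairs-ordered m)))) ⟩
  #balanced m k ^ n + length (pairsOf (columnPairs m)) * (a ∸ 1) ^ n ∎
  where
  open ≤-Reasoning
  m = 2 * k
  a = #agreeing m k
  both-bounded : ∀ {PQ} → Ordered (proj₁ PQ) × Ordered (proj₂ PQ) × proj₁ PQ ≢ proj₂ PQ →
                 rowsAgreeingBoth k PQ ^ n ≤ (a ∸ 1) ^ n
  both-bounded {(i , j) , Q} (i<j , ordQ , P≢Q) = ^-monoˡ-≤ n (∸-monoˡ-≤ 1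
    (subst (rowsAgreeingBoth k ((i , j) , Q) <_) (rowsAgreeing≡ k i j (Finₚ.<⇒≢ i<j))
           (rowsAgreeingBoth<rowsAgreeing k i<j ordQ P≢Q 3≤k (k<2*k (≤-trans (s≤s z≤n) 3≤k)))))

theorem3p4 : (k : ℕ) → k ≥ 3 → ∃ λ N → (n : ℕ) → n ≥ N → n ≥ 1 →
    M (n ∸ 1) k * M (suc n) k < M n k * M n k
theorem3p4 0                          ()
theorem3p4 1                          (s≤s ())
theorem3p4 2                          (s≤s (s≤s ()))
theorem3p4 k@(suc (suc (suc _))) 3≤k =
  eventually-log-concave (λ n → M n k) (#balanced (2 * k) k) a (a ∸ 1) p q
    (sym (m+[n∸m]≡n 1≤a)) a<#balanced (∈-length (∈-columnPairs {i = 0ᶠ} {1ᶠ} 0<1))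
    (λ n → M-lower-bound n k) (λ n → M-upper-bound n k 3≤k)
  where
  a = #agreeing (2 * k) k
  p = length (columnPairs (2 * k))
  q = length (pairsOf (columnPairs (2 * k)))
  k<2k = k<2*k (≤-trans (s≤s z≤n) 3≤k)
  0ᶠ 1ᶠ 2ᶠ : Fin (2 * k)
  0ᶠ = zero
  1ᶠ = suc zero
  2ᶠ = suc (suc zero)
  0<1 : 0ᶠ F.< 1ᶠ
  0<1 = s≤s z≤n
  0<2 : 0ᶠ F.< 2ᶠ
  0<2 = s≤s z≤n
  agreeing≡a : rowsAgreeing k (0ᶠ , 1ᶠ) ≡ a
  agreeing≡a = rowsAgreeing≡ k 0ᶠ 1ᶠ (λ ())
  a<#balanced : a < #balanced (2 * k) k
  a<#balanced = subst (_< #balanced (2 * k) k) agreeing≡a (rowsAgreeing<#balanced k 0ᶠ 1ᶠ (λ ()) (s≤s z≤n) k<2k)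
  1≤a : 1 ≤ a
  1≤a = ≤-trans (s≤s z≤n) (subst (rowsAgreeingBoth k ((0ᶠ , 1ᶠ) , (0ᶠ , 2ᶠ)) <_) agreeing≡a
                                 (rowsAgreeingBoth<rowsAgreeing k 0<1 0<2 (λ ()) 3≤k k<2k))
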